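{- For any prime $p$ and any positive integer $e$, $\sigma^{**}(p^e)/p^e\ge 1+1/p^2$. Moreover, $\sigma^{**}(p^e)/p^e\ge 1+1/p$ unless $e=2$, and $\sigma^{**}(p^e)/p^e\ge (1+1/p)(1+1/p^3)$ if $e\ge 3$. More generally, for any positive integers $m$ and $e\ge 2m-1$, we have $\sigma^{**}(p^e)/p^e\ge \sigma^{**}(p^{2m})/p^{2m}$, and, unless $e=2m$, $\sigma^{**}(p^e)/p^e\ge 1+1/p+\cdots+1/p^m$.
   Context: A divisor $d$ of $n$ is a unitary divisor if $\gcd(d,n/d)=1$; $\gcd_1(a,b)$ is the greatest common unitary divisor of $a$ and $b$; a divisor $d$ of $n$ is biunitary if $\gcd_1(d,n/d)=1$; $\sigma^{**}(n)$ is the sum of the biunitary divisors of $n$. For a prime $p$ and $e\ge1$: $\sigma^{**}(p^e)=\frac{p^{e+1}-1}{p-1}$ if $e$ is odd and $\sigma^{**}(p^e)=\frac{p^{e+1}-1}{p-1}-p^{e/2}$ if $e$ is even. -}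

module Defs where

open import Data.Bool using (Bool; true; false; _∧_)
open import Data.Nat using (ℕ; zero; suc; _+_; _*_; _^_; _⊔_; _≟_)
open import Data.Nat.DivMod using (_/_)
open import Data.Nat.Divisibility using (_∣?_)
open import Data.Nat.GCD using (gcd)
open import Data.List using (List; upTo; filterᵇ; foldr; map)
open import Data.Nat.ListAction using (sum)
open import Relation.Nullary.Decidable using (⌊_⌋)

isUnitaryDivisor : ℕ → ℕ → Bool
isUnitaryDivisor zero    n = false
isUnitaryDivisor (suc k) n = ⌊ suc k ∣? n ⌋ ∧ ⌊ gcd (suc k) (n / suc k) ≟ 1 ⌋

-- gcd₁ a b : greatest common unitary divisor of a and b
-- (any common unitary divisor of a lies in 1 .. a when a ≥ 1; returns 0 if there is none)
gcd₁ : ℕ → ℕ → ℕ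
gcd₁ a b = foldr _⊔_ 0 (filterᵇ (λ d → isUnitaryDivisor d a ∧ isUnitaryDivisor d b) (upTo (suc a)))

isBiunitaryDivisor : ℕ → ℕ → Bool
isBiunitaryDivisor zero    n = false
isBiunitaryDivisor (suc k) n = ⌊ suc k ∣? n ⌋ ∧ ⌊ gcd₁ (suc k) (n / suc k) ≟ 1 ⌋

-- σ** n : sum of the biunitary divisors of n (all of them lie in 0 .. n for n ≥ 1)
σ** : ℕ → ℕ
σ** n = sum (filterᵇ (λ d → isBiunitaryDivisor d n) (upTo (suc n)))

geomSum : ℕ → ℕ → ℕ
geomSum p m = sum (map (p ^_) (upTo (suc m)))

{-# OPTIONS --safe #-}

-- The biunitary divisors of p^e are the p^i, i ≤ e, except p^k when e = 2k ≥ 2: for i ≠ j the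
-- only common unitary divisor of p^i and p^j is 1, whereas gcd₁(p^k, p^k) = p^k. Hence
-- σ**(p^e) = 1 + p + ⋯ + p^e for odd e, and σ**(p^2k) = (1 + p^(k+1))(1 + p + ⋯ + p^(k-1)).
-- Divided by p^e, the odd case is Σ_{j ≤ e} p^-j ≥ Σ_{j ≤ m} p^-j, and for e = 2k with k > m
-- the terms j < k alone give Σ_{j < k} p^-j ≥ Σ_{j ≤ m} p^-j. Conversely
-- σ**(p^2m)/p^2m ≤ Σ_{j ≤ m} p^-j, since Σ_{m < j ≤ 2m} p^-j < p^-m; chaining the two bounds
-- compares σ**(p^e)/p^e with σ**(p^2m)/p^2m. The first three claims are the cases m = 1, 2,
-- with σ**(p²) = p² + 1 and σ**(p⁴) = (p + 1)(p³ + 1).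
module Submission where

open import Defs
open import Data.Nat using (ℕ; _+_; _*_; _∸_; _^_; _≤_; _≥_)
open import Data.Nat.Primality using (Prime)
open import Data.Product using (_×_)
open import Relation.Binary.PropositionalEquality using (_≢_)

open import Data.Bool using (Bool; true; false; T; _∧_; if_then_else_)
open import Data.Bool.Properties using (T-∧)
open import Data.Empty using (⊥-elim)
open import Data.List using ([]; _∷_; [_]; _++_; applyUpTo; upTo; filterᵇ; map)
open import Data.List.Properties using (applyUpTo-∷ʳ; map-upTo; foldr-preservesᵇ; foldr-preservesᵒ)
open import Data.List.Membership.Propositional using (_∈_)
open import Data.List.Membership.Propositional.Properties using (∈-filter⁺; ∈-upTo⁺)
import Data.List.Relation.Unary.All as All
open import Data.List.Relation.Unary.All.Properties using (all-filter)
import Data.List.Relation.Unary.Any as Any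
open import Data.Nat
  using (zero; suc; _<_; _≟_; z≤n; s≤s; z<s; s<s; NonZero; >-nonZero; ≢-nonZero⁻¹; nonTrivial⇒n>1)
open import Data.Nat.Coprimality using (Coprime; coprime-divisor; gcd≡1⇒coprime)
open import Data.Nat.Divisibility
  using (_∣_; _∣?_; divides; 1∣_; ∣-refl; ∣1⇒≡1; ∣⇒≤; m∣m*n; *-cancelˡ-∣)
open import Data.Nat.DivMod using (_/_; /-congˡ; m*n/n≡m; n/n≡1)
open import Data.Nat.GCD using (gcd; gcd-zeroˡ; gcd-zeroʳ)
open import Data.Nat.ListAction using (sum)
open import Data.Nat.ListAction.Properties using (sum-++)
open import Data.Nat.Primality using (prime⇒irreducible; prime⇒nonZero; prime⇒nonTrivial)
open import Data.Nat.Properties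
open import Algebra.Properties.CommutativeSemigroup *-commutativeSemigroup
  using (x∙yz≈zx∙y; xy∙z≈xz∙y; xy∙z≈zx∙y)
open import Data.Nat.Tactic.RingSolver using (solve-∀)
open import Data.Product using (∃-syntax; _,_; proj₁; proj₂)
open import Data.Sum using (_⊎_; inj₁; inj₂; [_,_]′)
open import Data.Unit using (tt)
open import Function using (_∘_; Equivalence)
open import Relation.Binary.PropositionalEquality
  using (_≡_; refl; sym; trans; cong; cong₂; subst; subst₂; module ≡-Reasoning)
open import Relation.Nullary using (¬_; Dec; yes; no)
open import Relation.Nullary.Decidable using (⌊_⌋; T?)

if-T : ∀ {a} {A : Set a} {b} {x y : A} → T b → (if b then x else y) ≡ x
if-T {b = true} _ = refl

if-¬T : ∀ {a} {A : Set a} {b} {x y : A} → ¬ T b → (if b then x else y) ≡ y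
if-¬T {b = true}  ¬t = ⊥-elim (¬t tt)
if-¬T {b = false} _  = refl

sum-filterᵇ : ∀ (P : ℕ → Bool) xs →
              sum (filterᵇ P xs) ≡ sum (map (λ x → if P x then x else 0) xs)
sum-filterᵇ P []       = refl
sum-filterᵇ P (x ∷ xs) with P x
... | true  = cong (x +_) (sum-filterᵇ P xs)
... | false = sum-filterᵇ P xs

sum-applyUpTo-suc : ∀ (f : ℕ → ℕ) n → sum (applyUpTo f (suc n)) ≡ sum (applyUpTo f n) + f n
sum-applyUpTo-suc f n = begin
  sum (applyUpTo f (suc n))        ≡⟨ cong sum (applyUpTo-∷ʳ f n) ⟨
  sum (applyUpTo f n ++ [ f n ])   ≡⟨ sum-++ (applyUpTo f n) [ f n ] ⟩
  sum (applyUpTo f n) + (f n + 0)  ≡⟨ cong (sum (applyUpTo f n) +_) (+-identityʳ (f n)) ⟩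
  sum (applyUpTo f n) + f n        ∎
  where open ≡-Reasoning

sum-applyUpTo-cong : ∀ {f g : ℕ → ℕ} n → (∀ {i} → i < n → f i ≡ g i) →
                     sum (applyUpTo f n) ≡ sum (applyUpTo g n)
sum-applyUpTo-cong zero    _   = refl
sum-applyUpTo-cong (suc n) f≗g = cong₂ _+_ (f≗g z<s) (sum-applyUpTo-cong n (f≗g ∘ s<s))

sum-applyUpTo-zeros : ∀ (f : ℕ → ℕ) a k → (∀ {j} → j < k → f (a + j) ≡ 0) →
                      sum (applyUpTo f (a + k)) ≡ sum (applyUpTo f a)
sum-applyUpTo-zeros f a zero    _     = cong (sum ∘ applyUpTo f) (+-identityʳ a)
sum-applyUpTo-zeros f a (suc k) zeros = begin
  sum (applyUpTo f (a + suc k))          ≡⟨ cong (sum ∘ applyUpTo f) (+-suc a k) ⟩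
  sum (applyUpTo f (suc (a + k)))        ≡⟨ sum-applyUpTo-suc f (a + k) ⟩
  sum (applyUpTo f (a + k)) + f (a + k)  ≡⟨ cong₂ _+_ (sum-applyUpTo-zeros f a k (zeros ∘ m<n⇒m<1+n))
                                                       (zeros (n<1+n k)) ⟩
  sum (applyUpTo f a) + 0                ≡⟨ +-identityʳ _ ⟩
  sum (applyUpTo f a)                    ∎
  where open ≡-Reasoning

sum-applyUpTo-sparse : ∀ (f g : ℕ → ℕ) → (∀ i → f i < f (suc i)) →
                       (∀ {d} → d < f 0 → g d ≡ 0) →
                       (∀ i {d} → f i < d → d < f (suc i) → g d ≡ 0) →
                       ∀ n → sum (applyUpTo g (suc (f n))) ≡ sum (applyUpTo (g ∘ f) (suc n))
sum-applyUpTo-sparse f g f-inc g-below g-gap = through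
  where
  open ≡-Reasoning
  below   : ∀ n → sum (applyUpTo g (f n)) ≡ sum (applyUpTo (g ∘ f) n)
  through : ∀ n → sum (applyUpTo g (suc (f n))) ≡ sum (applyUpTo (g ∘ f) (suc n))
  through n = begin
    sum (applyUpTo g (suc (f n)))        ≡⟨ sum-applyUpTo-suc g (f n) ⟩
    sum (applyUpTo g (f n)) + g (f n)    ≡⟨ cong (_+ g (f n)) (below n) ⟩
    sum (applyUpTo (g ∘ f) n) + g (f n)  ≡⟨ sum-applyUpTo-suc (g ∘ f) n ⟨
    sum (applyUpTo (g ∘ f) (suc n))      ∎
  below zero = sum-applyUpTo-zeros g 0 (f 0) g-below
  below (suc n) with k , fn+1+k≡ ← m≤n⇒∃[o]m+o≡n (f-inc n) = begin
    sum (applyUpTo g (f (suc n)))      ≡⟨ cong (sum ∘ applyUpTo g) fn+1+k≡ ⟨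
    sum (applyUpTo g (suc (f n) + k))  ≡⟨ sum-applyUpTo-zeros g (suc (f n)) k gap ⟩
    sum (applyUpTo g (suc (f n)))      ≡⟨ through n ⟩
    sum (applyUpTo (g ∘ f) (suc n))    ∎
    where
    gap : ∀ {j} → j < k → g (suc (f n) + j) ≡ 0
    gap {j} j<k = g-gap n (s≤s (m≤m+n (f n) j)) (subst (suc (f n) + j <_) fn+1+k≡ (+-monoʳ-< (suc (f n)) j<k))

sum-applyUpTo-hole : ∀ {f g : ℕ → ℕ} {m} n → m < n → f m ≡ 0 →
                     (∀ {i} → i < n → i ≢ m → f i ≡ g i) →
                     sum (applyUpTo f n) + g m ≡ sum (applyUpTo g n)
sum-applyUpTo-hole {f} {g} {zero} (suc n) _ f0≡0 f≗g = begin
  f 0 + sum (applyUpTo (f ∘ suc) n) + g 0  ≡⟨ cong (λ x → x + sum (applyUpTo (f ∘ suc) n) + g 0) f0≡0 ⟩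
  sum (applyUpTo (f ∘ suc) n) + g 0        ≡⟨ +-comm _ (g 0) ⟩
  g 0 + sum (applyUpTo (f ∘ suc) n)        ≡⟨ cong (g 0 +_) (sum-applyUpTo-cong n (λ i<n → f≗g (s<s i<n) λ ())) ⟩
  g 0 + sum (applyUpTo (g ∘ suc) n)        ∎
  where open ≡-Reasoning
sum-applyUpTo-hole {f} {g} {suc m} (suc n) (s<s m<n) fm≡0 f≗g = begin
  f 0 + sum (applyUpTo (f ∘ suc) n) + g (suc m)    ≡⟨ +-assoc (f 0) _ _ ⟩
  f 0 + (sum (applyUpTo (f ∘ suc) n) + g (suc m))  ≡⟨ cong₂ _+_ (f≗g z<s λ ()) (sum-applyUpTo-hole n m<n fm≡0 tail) ⟩
  g 0 + sum (applyUpTo (g ∘ suc) n)                ∎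
  where
  open ≡-Reasoning
  tail : ∀ {i} → i < n → i ≢ m → f (suc i) ≡ g (suc i)
  tail i<n i≢m = f≗g (s<s i<n) (i≢m ∘ suc-injective)

repunit : ℕ → ℕ → ℕ
repunit b n = sum (applyUpTo (b ^_) n)

geomSum≡repunit : ∀ b m → geomSum b m ≡ repunit b (suc m)
geomSum≡repunit b m = cong sum (map-upTo (b ^_) (suc m))

repunit-+ : ∀ b m n → repunit b (m + n) ≡ repunit b n + b ^ n * repunit b m
repunit-+ b zero    n = sym (trans (cong (repunit b n +_) (*-zeroʳ (b ^ n))) (+-identityʳ _))
repunit-+ b (suc m) n = begin
  repunit b (suc (m + n))                             ≡⟨ sum-applyUpTo-suc (b ^_) (m + n) ⟩
  repunit b (m + n) + b ^ (m + n)                     ≡⟨ cong₂ _+_ (repunit-+ b m n) (^-distribˡ-+-* b m n) ⟩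
  repunit b n + b ^ n * repunit b m + b ^ m * b ^ n   ≡⟨ regroup (repunit b n) (b ^ n) (repunit b m) (b ^ m) ⟩
  repunit b n + b ^ n * (repunit b m + b ^ m)         ≡⟨ cong (λ x → repunit b n + b ^ n * x) (sum-applyUpTo-suc (b ^_) m) ⟨
  repunit b n + b ^ n * repunit b (suc m)             ∎
  where
  open ≡-Reasoning
  regroup : ∀ r q s t → r + q * s + t * q ≡ r + q * (s + t)
  regroup = solve-∀

repunit-suc : ∀ b n → repunit b (suc n) ≡ 1 + b * repunit b n
repunit-suc b n = begin
  repunit b (suc n)          ≡⟨ cong (repunit b) (+-comm 1 n) ⟩
  repunit b (n + 1)          ≡⟨ repunit-+ b n 1 ⟩
  1 + b * 1 * repunit b n    ≡⟨ cong (λ x → 1 + x * repunit b n) (*-identityʳ b) ⟩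
  1 + b * repunit b n        ∎
  where open ≡-Reasoning

repunit-1+2*k : ∀ b k → repunit b (suc (2 * k)) ≡ repunit b k + b ^ suc k * repunit b k + b ^ k
repunit-1+2*k b k = begin
  repunit b (suc (2 * k))                         ≡⟨ cong (λ x → repunit b (suc (k + x))) (+-identityʳ k) ⟩
  repunit b (suc k + k)                           ≡⟨ repunit-+ b (suc k) k ⟩
  repunit b k + b ^ k * repunit b (suc k)         ≡⟨ cong (λ x → repunit b k + b ^ k * x) (repunit-suc b k) ⟩
  repunit b k + b ^ k * (1 + b * repunit b k)     ≡⟨ regroup (repunit b k) (b ^ k) b ⟩
  repunit b k + b ^ suc k * repunit b k + b ^ k   ∎
  where
  open ≡-Reasoning
  regroup : ∀ r q x → r + q * (1 + x * r) ≡ r + x * q * r + q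
  regroup = solve-∀

repunit-2 : ∀ b → repunit b 2 ≡ b + 1
repunit-2 b = trans (+-comm 1 (b * 1 + 0)) (cong (_+ 1) (trans (+-identityʳ (b * 1)) (*-identityʳ b)))

repunit<^ : ∀ {b} → 1 < b → ∀ n → repunit b n < b ^ n
repunit<^ 1<b zero = z<s
repunit<^ {b} 1<b (suc n) = begin-strict
  repunit b (suc n)    ≡⟨ sum-applyUpTo-suc (b ^_) n ⟩
  repunit b n + b ^ n  <⟨ +-monoˡ-< (b ^ n) (repunit<^ 1<b n) ⟩
  b ^ n + b ^ n        ≡⟨ cong (b ^ n +_) (+-identityʳ (b ^ n)) ⟨
  2 * b ^ n            ≤⟨ *-monoˡ-≤ (b ^ n) 1<b ⟩
  b * b ^ n            ∎
  where open ≤-Reasoning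

-- Ratios a / x ≤ b / y are stated cross-multiplied, as a * y ≤ b * x.
repunit-ratio-mono : ∀ b {m n} → m ≤ n → repunit b (suc m) * b ^ n ≤ repunit b (suc n) * b ^ m
repunit-ratio-mono b {m} m≤n with t , refl ← m≤n⇒∃[o]m+o≡n m≤n = begin
  repunit b (suc m) * b ^ (m + t)                        ≡⟨ cong (repunit b (suc m) *_) (^-distribˡ-+-* b m t) ⟩
  repunit b (suc m) * (b ^ m * b ^ t)                    ≡⟨ x∙yz≈zx∙y (repunit b (suc m)) (b ^ m) (b ^ t) ⟩
  b ^ t * repunit b (suc m) * b ^ m                      ≤⟨ *-monoˡ-≤ (b ^ m) (m≤n+m _ (repunit b t)) ⟩
  (repunit b t + b ^ t * repunit b (suc m)) * b ^ m      ≡⟨ cong (_* b ^ m) (repunit-+ b (suc m) t) ⟨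
  repunit b (suc (m + t)) * b ^ m                        ∎
  where open ≤-Reasoning

ratio-≤-trans : ∀ a x b y c z .{{_ : NonZero y}} →
                a * y ≤ b * x → b * z ≤ c * y → a * z ≤ c * x
ratio-≤-trans a x b y c z ay≤bx bz≤cy = *-cancelʳ-≤ (a * z) (c * x) y (begin
  a * z * y  ≡⟨ xy∙z≈xz∙y a z y ⟩
  a * y * z  ≤⟨ *-monoˡ-≤ z ay≤bx ⟩
  b * x * z  ≡⟨ xy∙z≈xz∙y b x z ⟩
  b * z * x  ≤⟨ *-monoˡ-≤ x bz≤cy ⟩
  c * y * x  ≡⟨ xy∙z≈xz∙y c y x ⟩
  c * x * y  ∎)
  where open ≤-Reasoning

even⊎odd : ∀ n → (∃[ k ] n ≡ 2 * k) ⊎ (∃[ k ] n ≡ suc (2 * k))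
even⊎odd zero = inj₁ (0 , refl)
even⊎odd (suc n) with even⊎odd n
... | inj₁ (k , refl) = inj₂ (k , refl)
... | inj₂ (k , refl) = inj₁ (suc k , cong suc (sym (+-suc k (k + 0))))

m≤2*m∸1 : ∀ m → m ≤ 2 * m ∸ 1
m≤2*m∸1 zero    = z≤n
m≤2*m∸1 (suc m) = subst (suc m ≤_) (sym (+-suc m (m + 0))) (s≤s (m≤m+n m (m + 0)))

2*m∸1≤2*k⇒m≤k : ∀ {m k} → 2 * m ∸ 1 ≤ 2 * k → m ≤ k
2*m∸1≤2*k⇒m≤k {m} {k} h = ≮⇒≥ λ k<m → <⇒≱ (begin-strict
  2 * k          <⟨ n<1+n (2 * k) ⟩
  suc (2 * k)    ≡⟨ +-suc k (k + 0) ⟨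
  2 * suc k ∸ 1  ≤⟨ ∸-monoˡ-≤ 1 (*-monoʳ-≤ 2 k<m) ⟩
  2 * m ∸ 1      ∎) h
  where open ≤-Reasoning

module _ {b : ℕ} (1<b : 1 < b) where
  private instance
    b≢0 : NonZero b
    b≢0 = >-nonZero (<-trans z<s 1<b)

  ^-cancelˡ-< : ∀ {i j} → b ^ i < b ^ j → i < j
  ^-cancelˡ-< b^i<b^j = ≰⇒> λ j≤i → <⇒≱ b^i<b^j (^-monoʳ-≤ b j≤i)

  ^-injective : ∀ {i j} → b ^ i ≡ b ^ j → i ≡ j
  ^-injective {i} {j} b^i≡b^j = ≤-antisym
    (≮⇒≥ λ j<i → <-irrefl (sym b^i≡b^j) (^-monoʳ-< b 1<b j<i))
    (≮⇒≥ λ i<j → <-irrefl b^i≡b^j (^-monoʳ-< b 1<b i<j))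

m^[i+j]/m^i≡m^j : ∀ m i j .{{_ : NonZero m}} → (m ^ (i + j) / m ^ i) {{m^n≢0 m i}} ≡ m ^ j
m^[i+j]/m^i≡m^j m i j = begin
  m ^ (i + j) / m ^ i    ≡⟨ /-congˡ {o = m ^ i} (trans (^-distribˡ-+-* m i j) (*-comm (m ^ i) (m ^ j))) ⟩
  m ^ j * m ^ i / m ^ i  ≡⟨ m*n/n≡m (m ^ j) (m ^ i) ⟩
  m ^ j                  ∎
  where
  open ≡-Reasoning
  instance
    m^i≢0 : NonZero (m ^ i)
    m^i≢0 = m^n≢0 m i

toWitness-∧ : ∀ {a b} {A : Set a} {B : Set b} (a? : Dec A) (b? : Dec B) → T (⌊ a? ⌋ ∧ ⌊ b? ⌋) → A × B
toWitness-∧ (yes a) (yes b) _ = a , b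

fromWitness-∧ : ∀ {a b} {A : Set a} {B : Set b} (a? : Dec A) (b? : Dec B) → A → B → T (⌊ a? ⌋ ∧ ⌊ b? ⌋)
fromWitness-∧ (yes _) (yes _)  _ _ = tt
fromWitness-∧ (yes _) (no ¬b) _ b = ¬b b
fromWitness-∧ (no ¬a) _       a _ = ¬a a

unitary⇒∣ : ∀ {d n} → T (isUnitaryDivisor d n) → d ∣ n
unitary⇒∣ {suc k} {n} u = proj₁ (toWitness-∧ (suc k ∣? n) (gcd (suc k) (n / suc k) ≟ 1) u)

unitary⇒coprime : ∀ d n .{{_ : NonZero d}} → T (isUnitaryDivisor d n) → gcd d (n / d) ≡ 1
unitary⇒coprime (suc k) n u = proj₂ (toWitness-∧ (suc k ∣? n) (gcd (suc k) (n / suc k) ≟ 1) u)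

unitary-1 : ∀ n → T (isUnitaryDivisor 1 n)
unitary-1 n = fromWitness-∧ (1 ∣? n) (gcd 1 (n / 1) ≟ 1) (1∣ n) (gcd-zeroˡ (n / 1))

unitary-refl : ∀ n .{{_ : NonZero n}} → T (isUnitaryDivisor n n)
unitary-refl n@(suc _) = fromWitness-∧ (n ∣? n) (gcd n (n / n) ≟ 1)
  ∣-refl (trans (cong (gcd n) (n/n≡1 n)) (gcd-zeroʳ n))

isCommonUnitaryDivisor : ℕ → ℕ → ℕ → Bool
isCommonUnitaryDivisor a b d = isUnitaryDivisor d a ∧ isUnitaryDivisor d b

gcd₁-≤ : ∀ a b {k} → (∀ {d} → T (isUnitaryDivisor d a) → T (isUnitaryDivisor d b) → d ≤ k) →
         gcd₁ a b ≤ k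
gcd₁-≤ a b {k} common≤k = foldr-preservesᵇ {P = _≤ k} ⊔-lub z≤n
  (All.map (λ {d} u → let ua , ub = Equivalence.to (T-∧ {isUnitaryDivisor d a}) u in common≤k ua ub)
           (all-filter (T? ∘ isCommonUnitaryDivisor a b) (upTo (suc a))))

≤-gcd₁ : ∀ {a b d} → d ≤ a → T (isUnitaryDivisor d a) → T (isUnitaryDivisor d b) → d ≤ gcd₁ a b
≤-gcd₁ {a} {b} {d} d≤a ua ub =
  foldr-preservesᵒ {P = d ≤_} (λ x y → [ m≤n⇒m≤n⊔o y , m≤n⇒m≤o⊔n x ]′) 0 _ (inj₂ (Any.map ≤-reflexive d∈))
  where
  d∈ : d ∈ filterᵇ (isCommonUnitaryDivisor a b) (upTo (suc a))
  d∈ = ∈-filter⁺ (T? ∘ isCommonUnitaryDivisor a b) (∈-upTo⁺ (s≤s d≤a)) (Equivalence.from T-∧ (ua , ub))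

gcd₁-idem : ∀ n .{{_ : NonZero n}} → gcd₁ n n ≡ n
gcd₁-idem n = ≤-antisym (gcd₁-≤ n n λ u _ → ∣⇒≤ (unitary⇒∣ u))
                        (≤-gcd₁ ≤-refl (unitary-refl n) (unitary-refl n))

biunitary⇒∣ : ∀ {d n} → T (isBiunitaryDivisor d n) → d ∣ n
biunitary⇒∣ {suc k} {n} bu = proj₁ (toWitness-∧ (suc k ∣? n) (gcd₁ (suc k) (n / suc k) ≟ 1) bu)

biunitary⇒gcd₁≡1 : ∀ d n .{{_ : NonZero d}} → T (isBiunitaryDivisor d n) → gcd₁ d (n / d) ≡ 1
biunitary⇒gcd₁≡1 (suc k) n bu = proj₂ (toWitness-∧ (suc k ∣? n) (gcd₁ (suc k) (n / suc k) ≟ 1) bu)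

biunitary-intro : ∀ d n .{{_ : NonZero d}} → d ∣ n → gcd₁ d (n / d) ≡ 1 → T (isBiunitaryDivisor d n)
biunitary-intro (suc k) n = fromWitness-∧ (suc k ∣? n) (gcd₁ (suc k) (n / suc k) ≟ 1)

biunitaryPart : ℕ → ℕ → ℕ
biunitaryPart n d = if isBiunitaryDivisor d n then d else 0

σ**≡sum-biunitaryPart : ∀ n → σ** n ≡ sum (applyUpTo (biunitaryPart n) (suc n))
σ**≡sum-biunitaryPart n = trans (sum-filterᵇ (λ d → isBiunitaryDivisor d n) (upTo (suc n)))
                               (cong sum (map-upTo (biunitaryPart n) (suc n)))

module _ {p : ℕ} (p-prime : Prime p) where
  private
    1<p : 1 < p
    1<p = nonTrivial⇒n>1 p {{prime⇒nonTrivial p-prime}}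
    instance
      p≢0 : NonZero p
      p≢0 = prime⇒nonZero p-prime

  ∣p^⇒≡p^ : ∀ e {d} → d ∣ p ^ e → ∃[ i ] i ≤ e × d ≡ p ^ i
  ∣p^⇒≡p^ zero    d∣1 = 0 , z≤n , ∣1⇒≡1 d∣1
  ∣p^⇒≡p^ (suc e) {d} d∣p^1+e with p ∣? d
  ... | yes (divides k refl) =
    let i , i≤e , k≡p^i = ∣p^⇒≡p^ e (*-cancelˡ-∣ p (subst (_∣ p * p ^ e) (*-comm k p) d∣p^1+e))
    in suc i , s≤s i≤e , trans (cong (_* p) k≡p^i) (*-comm (p ^ i) p)
  ... | no p∤d =
    let i , i≤e , d≡p^i = ∣p^⇒≡p^ e (coprime-divisor d⊥p d∣p^1+e)
    in i , m≤n⇒m≤1+n i≤e , d≡p^i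
    where
    d⊥p : Coprime d p
    d⊥p (c∣d , c∣p) with prime⇒irreducible p-prime c∣p
    ... | inj₁ c≡1    = c≡1
    ... | inj₂ refl = ⊥-elim (p∤d c∣d)

  unitary-p^ : ∀ i {d} → T (isUnitaryDivisor d (p ^ i)) → d ≡ 1 ⊎ d ≡ p ^ i
  unitary-p^ i {d} u with ∣p^⇒≡p^ i (unitary⇒∣ {d} u)
  ... | zero  , _   , refl = inj₁ refl
  ... | suc s , s<i , refl with m≤n⇒∃[o]m+o≡n s<i
  ...   | zero  , refl = inj₂ (cong (p ^_) (sym (+-identityʳ (suc s))))
  ...   | suc t , refl = ⊥-elim (<-irrefl (sym p≡1) 1<p)
    where
    p^s⊥p^t : gcd (p ^ suc s) (p ^ suc t) ≡ 1
    p^s⊥p^t = trans (cong (gcd (p ^ suc s)) (sym (m^[i+j]/m^i≡m^j p (suc s) (suc t))))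
                    (unitary⇒coprime (p ^ suc s) (p ^ (suc s + suc t)) {{m^n≢0 p (suc s)}} u)
    p≡1 : p ≡ 1
    p≡1 = gcd≡1⇒coprime p^s⊥p^t (m∣m*n (p ^ s) , m∣m*n (p ^ t))

  gcd₁[p^i,p^j]≡1 : ∀ {i j} → i ≢ j → gcd₁ (p ^ i) (p ^ j) ≡ 1
  gcd₁[p^i,p^j]≡1 {i} {j} i≢j =
    ≤-antisym (gcd₁-≤ (p ^ i) (p ^ j) common≤1) (≤-gcd₁ (m^n>0 p i) (unitary-1 (p ^ i)) (unitary-1 (p ^ j)))
    where
    common≤1 : ∀ {d} → T (isUnitaryDivisor d (p ^ i)) → T (isUnitaryDivisor d (p ^ j)) → d ≤ 1
    common≤1 {d} ui uj with unitary-p^ i {d} ui | unitary-p^ j {d} uj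
    ... | inj₁ refl | _         = ≤-refl
    ... | inj₂ _    | inj₁ refl = ≤-refl
    ... | inj₂ refl | inj₂ p^i≡p^j = ⊥-elim (i≢j (^-injective 1<p p^i≡p^j))

  p^i-biunitary : ∀ {i j} → i ≢ j → T (isBiunitaryDivisor (p ^ i) (p ^ (i + j)))
  p^i-biunitary {i} {j} i≢j = biunitary-intro (p ^ i) (p ^ (i + j)) {{m^n≢0 p i}}
    (subst (p ^ i ∣_) (sym (^-distribˡ-+-* p i j)) (m∣m*n (p ^ j)))
    (trans (cong (gcd₁ (p ^ i)) (m^[i+j]/m^i≡m^j p i j)) (gcd₁[p^i,p^j]≡1 i≢j))

  p^i-not-biunitary : ∀ {i} .{{_ : NonZero i}} → ¬ T (isBiunitaryDivisor (p ^ i) (p ^ (2 * i)))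
  p^i-not-biunitary {i} bu = ≢-nonZero⁻¹ i (^-injective 1<p p^i≡1)
    where
    instance
      p^i≢0 : NonZero (p ^ i)
      p^i≢0 = m^n≢0 p i
    p^i≡1 : p ^ i ≡ 1
    p^i≡1 = begin
      p ^ i                              ≡⟨ gcd₁-idem (p ^ i) ⟨
      gcd₁ (p ^ i) (p ^ i)               ≡⟨ cong (λ x → gcd₁ (p ^ i) (p ^ x)) (+-identityʳ i) ⟨
      gcd₁ (p ^ i) (p ^ (i + 0))         ≡⟨ cong (gcd₁ (p ^ i)) (m^[i+j]/m^i≡m^j p i (i + 0)) ⟨
      gcd₁ (p ^ i) (p ^ (2 * i) / p ^ i) ≡⟨ biunitary⇒gcd₁≡1 (p ^ i) (p ^ (2 * i)) bu ⟩
      1                                  ∎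
      where open ≡-Reasoning

  σ**[p^e]≡sum : ∀ e → σ** (p ^ e) ≡ sum (applyUpTo (biunitaryPart (p ^ e) ∘ (p ^_)) (suc e))
  σ**[p^e]≡sum e = trans (σ**≡sum-biunitaryPart (p ^ e))
    (sum-applyUpTo-sparse (p ^_) (biunitaryPart (p ^ e)) (λ i → ^-monoʳ-< p 1<p (n<1+n i)) below-1 gap e)
    where
    off-powers : ∀ {d} → (∀ j → d ≢ p ^ j) → biunitaryPart (p ^ e) d ≡ 0
    off-powers d∉p^ℕ = if-¬T λ bu → let j , _ , d≡p^j = ∣p^⇒≡p^ e (biunitary⇒∣ bu) in d∉p^ℕ j d≡p^j
    below-1 : ∀ {d} → d < 1 → biunitaryPart (p ^ e) d ≡ 0
    below-1 {d} d<1 = off-powers λ j d≡p^j → <⇒≱ d<1 (subst (1 ≤_) (sym d≡p^j) (m^n>0 p j))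
    gap : ∀ i {d} → p ^ i < d → d < p ^ suc i → biunitaryPart (p ^ e) d ≡ 0
    gap i {d} p^i<d d<p^1+i = off-powers λ j d≡p^j →
      <⇒≱ (^-cancelˡ-< 1<p {i} {j} (subst (p ^ i <_) d≡p^j p^i<d))
          (≤-pred (^-cancelˡ-< 1<p {j} {suc i} (subst (_< p ^ suc i) d≡p^j d<p^1+i)))

  biunitaryPart-p^ : ∀ {i e} → i ≤ e → 2 * i ≢ e → biunitaryPart (p ^ e) (p ^ i) ≡ p ^ i
  biunitaryPart-p^ {i} i≤e 2i≢e with t , refl ← m≤n⇒∃[o]m+o≡n i≤e =
    if-T (p^i-biunitary λ i≡t → 2i≢e (cong (i +_) (trans (+-identityʳ i) i≡t)))

  σ**[p^e]≡repunit : ∀ e → (∀ i → 2 * i ≢ e) → σ** (p ^ e) ≡ repunit p (suc e)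
  σ**[p^e]≡repunit e e-odd = trans (σ**[p^e]≡sum e)
    (sum-applyUpTo-cong (suc e) λ {i} i<1+e → biunitaryPart-p^ (≤-pred i<1+e) (e-odd i))

  σ**[p^2k]+p^k≡repunit : ∀ k .{{_ : NonZero k}} → σ** (p ^ (2 * k)) + p ^ k ≡ repunit p (suc (2 * k))
  σ**[p^2k]+p^k≡repunit k = trans (cong (_+ p ^ k) (σ**[p^e]≡sum (2 * k)))
    (sum-applyUpTo-hole (suc (2 * k)) (s≤s (m≤m+n k (k + 0))) (if-¬T p^i-not-biunitary)
      λ i<1+2k i≢k → biunitaryPart-p^ (≤-pred i<1+2k) (i≢k ∘ *-cancelˡ-≡ _ k 2))

  σ**[p^2k]≡[1+p^[1+k]]*repunit : ∀ k .{{_ : NonZero k}} → σ** (p ^ (2 * k)) ≡ (1 + p ^ suc k) * repunit p k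
  σ**[p^2k]≡[1+p^[1+k]]*repunit k = +-cancelʳ-≡ (p ^ k) _ _ (trans (σ**[p^2k]+p^k≡repunit k) (repunit-1+2*k p k))

  σ**[p²]≡p²+1 : σ** (p ^ 2) ≡ p ^ 2 + 1
  σ**[p²]≡p²+1 = trans (σ**[p^2k]≡[1+p^[1+k]]*repunit 1) (trans (*-identityʳ (1 + p ^ 2)) (+-comm 1 (p ^ 2)))

  σ**[p⁴]≡[p+1][p³+1] : σ** (p ^ 4) ≡ (p + 1) * (p ^ 3 + 1)
  σ**[p⁴]≡[p+1][p³+1] = begin
    σ** (p ^ 4)                ≡⟨ σ**[p^2k]≡[1+p^[1+k]]*repunit 2 ⟩
    (1 + p ^ 3) * repunit p 2  ≡⟨ cong ((1 + p ^ 3) *_) (repunit-2 p) ⟩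
    (1 + p ^ 3) * (p + 1)      ≡⟨ *-comm (1 + p ^ 3) (p + 1) ⟩
    (p + 1) * (1 + p ^ 3)      ≡⟨ cong ((p + 1) *_) (+-comm 1 (p ^ 3)) ⟩
    (p + 1) * (p ^ 3 + 1)      ∎
    where open ≡-Reasoning

  σ**-ratio[p^2m]≤repunit-ratio : ∀ m .{{_ : NonZero m}} →
                                 σ** (p ^ (2 * m)) * p ^ m ≤ repunit p (suc m) * p ^ (2 * m)
  σ**-ratio[p^2m]≤repunit-ratio m = begin
    σ** (p ^ (2 * m)) * p ^ m                        ≡⟨ cong (_* p ^ m) (σ**[p^2k]≡[1+p^[1+k]]*repunit m) ⟩
    (1 + p ^ suc m) * repunit p m * p ^ m            ≤⟨ *-monoˡ-≤ (p ^ m) (+-monoˡ-≤ _ (<⇒≤ (repunit<^ 1<p m))) ⟩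
    (p ^ m + p ^ suc m * repunit p m) * p ^ m        ≡⟨ cong (_* p ^ m) (regroup (p ^ m) p (repunit p m)) ⟩
    (1 + p * repunit p m) * p ^ m * p ^ m            ≡⟨ cong (λ r → r * p ^ m * p ^ m) (repunit-suc p m) ⟨
    repunit p (suc m) * p ^ m * p ^ m                ≡⟨ *-assoc (repunit p (suc m)) (p ^ m) (p ^ m) ⟩
    repunit p (suc m) * (p ^ m * p ^ m)              ≡⟨ cong (repunit p (suc m) *_) (^-distribˡ-+-* p m m) ⟨
    repunit p (suc m) * p ^ (m + m)                  ≡⟨ cong (λ x → repunit p (suc m) * p ^ (m + x)) (+-identityʳ m) ⟨
    repunit p (suc m) * p ^ (2 * m)                  ∎
    where
    open ≤-Reasoning
    regroup : ∀ q x r → q + x * q * r ≡ (1 + x * r) * q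
    regroup = solve-∀

  repunit-ratio≤σ**-ratio-odd : ∀ {m e} → m ≤ e → (∀ i → 2 * i ≢ e) →
                                repunit p (suc m) * p ^ e ≤ σ** (p ^ e) * p ^ m
  repunit-ratio≤σ**-ratio-odd {m} {e} m≤e e-odd =
    subst (λ s → repunit p (suc m) * p ^ e ≤ s * p ^ m) (sym (σ**[p^e]≡repunit e e-odd)) (repunit-ratio-mono p m≤e)

  repunit-ratio≤σ**-ratio-even : ∀ {m k} → m < k →
                                 repunit p (suc m) * p ^ (2 * k) ≤ σ** (p ^ (2 * k)) * p ^ m
  repunit-ratio≤σ**-ratio-even {m} {suc k} (s≤s m≤k) = begin
    R (suc m) * p ^ (2 * suc k)                          ≡⟨ cong (λ x → R (suc m) * p ^ x) (split k) ⟩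
    R (suc m) * p ^ (k + suc (suc k))                    ≡⟨ cong (R (suc m) *_) (^-distribˡ-+-* p k (suc (suc k))) ⟩
    R (suc m) * (p ^ k * p ^ suc (suc k))                ≡⟨ *-assoc (R (suc m)) (p ^ k) (p ^ suc (suc k)) ⟨
    R (suc m) * p ^ k * p ^ suc (suc k)                  ≤⟨ *-monoˡ-≤ _ (repunit-ratio-mono p m≤k) ⟩
    R (suc k) * p ^ m * p ^ suc (suc k)                  ≡⟨ xy∙z≈zx∙y (R (suc k)) (p ^ m) _ ⟩
    p ^ suc (suc k) * R (suc k) * p ^ m                  ≤⟨ *-monoˡ-≤ (p ^ m) (m≤n+m _ (R (suc k))) ⟩
    (1 + p ^ suc (suc k)) * R (suc k) * p ^ m            ≡⟨ cong (_* p ^ m) (σ**[p^2k]≡[1+p^[1+k]]*repunit (suc k)) ⟨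
    σ** (p ^ (2 * suc k)) * p ^ m                        ∎
    where
    open ≤-Reasoning
    R : ℕ → ℕ
    R = repunit p
    split : ∀ n → 2 * suc n ≡ n + suc (suc n)
    split = solve-∀

  repunit-ratio≤σ**-ratio : ∀ m {e} → 2 * m ∸ 1 ≤ e → e ≢ 2 * m →
                            repunit p (suc m) * p ^ e ≤ σ** (p ^ e) * p ^ m
  repunit-ratio≤σ**-ratio m {e} 2m∸1≤e e≢2m with even⊎odd e
  ... | inj₁ (k , refl) = repunit-ratio≤σ**-ratio-even {m} {k}
                            (≤∧≢⇒< (2*m∸1≤2*k⇒m≤k 2m∸1≤e) λ m≡k → e≢2m (cong (2 *_) (sym m≡k)))
  ... | inj₂ (k , refl) = repunit-ratio≤σ**-ratio-odd {m} (≤-trans (m≤2*m∸1 m) 2m∸1≤e) λ i → even≢odd i k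

  σ**-ratio[p^2m]≤σ**-ratio : ∀ m .{{_ : NonZero m}} → ∀ {e} → 2 * m ∸ 1 ≤ e →
                              σ** (p ^ (2 * m)) * p ^ e ≤ σ** (p ^ e) * p ^ (2 * m)
  σ**-ratio[p^2m]≤σ**-ratio m {e} 2m∸1≤e with e ≟ 2 * m
  ... | yes refl = ≤-refl
  ... | no e≢2m  = ratio-≤-trans (σ** (p ^ (2 * m))) (p ^ (2 * m))
                                 (repunit p (suc m)) (p ^ m)
                                 (σ** (p ^ e)) (p ^ e) {{m^n≢0 p m}}
                                 (σ**-ratio[p^2m]≤repunit-ratio m)
                                 (repunit-ratio≤σ**-ratio m 2m∸1≤e e≢2m)

lemma2p2 : (p e : ℕ) → Prime p → 1 ≤ e →
    (σ** (p ^ e) * p ^ 2 ≥ (p ^ 2 + 1) * p ^ e)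
    × (e ≢ 2 → σ** (p ^ e) * p ≥ (p + 1) * p ^ e)
    × (3 ≤ e → σ** (p ^ e) * p ^ 4 ≥ ((p + 1) * (p ^ 3 + 1)) * p ^ e)
    × ((m : ℕ) → 1 ≤ m → 2 * m ∸ 1 ≤ e →
        (σ** (p ^ e) * p ^ (2 * m) ≥ σ** (p ^ (2 * m)) * p ^ e)
        × (e ≢ 2 * m → σ** (p ^ e) * p ^ m ≥ geomSum p m * p ^ e))
lemma2p2 p e p-prime 1≤e =
    subst (λ s → s * p ^ e ≤ σ** (p ^ e) * p ^ 2) (σ**[p²]≡p²+1 p-prime)
          (σ**-ratio[p^2m]≤σ**-ratio p-prime 1 1≤e)
  , (λ e≢2 → subst₂ (λ r q → r * p ^ e ≤ σ** (p ^ e) * q) (repunit-2 p) (*-identityʳ p)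
                    (repunit-ratio≤σ**-ratio p-prime 1 1≤e e≢2))
  , (λ 3≤e → subst (λ s → s * p ^ e ≤ σ** (p ^ e) * p ^ 4) (σ**[p⁴]≡[p+1][p³+1] p-prime)
                   (σ**-ratio[p^2m]≤σ**-ratio p-prime 2 3≤e))
  , λ m 1≤m 2m∸1≤e →
      σ**-ratio[p^2m]≤σ**-ratio p-prime m {{>-nonZero 1≤m}} 2m∸1≤e
    , λ e≢2m → subst (λ g → g * p ^ e ≤ σ** (p ^ e) * p ^ m) (sym (geomSum≡repunit p m))
                     (repunit-ratio≤σ**-ratio p-prime m 2m∸1≤e e≢2m)
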